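{- Let $d>0$ and let $\mathbf A$ be the random $n\times n$ matrix over $\mathbb F_2$ with independent entries equal to $1$ with probability $p=\min\{d/n,1\}$. The set $U=V_{\mathtt s}(\mathbf A)\setminus\mathcal F(\mathbf A_{\mathtt s})$ is a flipper of $\mathbf A_{\mathtt s}$ of size $|U|\ge|V_{\mathtt s}(\mathbf A)|-|C_{\mathtt s}(\mathbf A)|$, and $U\cap\mathcal F(\mathbf A)=\emptyset$.
   Context: Tanner graph $G(A)$: bipartite graph with variable nodes (columns) and check nodes (rows), edge $a_iv_j$ iff $A_{ij}=1$; $\partial u$ denotes neighbourhood. For a matrix $B$, $\mathcal F(B)$ is the set of variable nodes (columns) $i$ with $x_i=0$ for all $x\in\ker B$. $G_{\mathtt s}(\mathbf A)$ is obtained from $G(\mathbf A)$ by repeatedly, while some variable or check node has degree at most one, deleting that node together with its neighbour (if any); its variable and check node sets are $V_{\mathtt s}(\mathbf A)$, $C_{\mathtt s}(\mathbf A)$, and $\mathbf A_{\mathtt s}$ is the minor of $\mathbf A$ with rows $C_{\mathtt s}(\mathbf A)$ and columns $V_{\mathtt s}(\mathbf A)$. A flipper of a matrix $B$ is a set $U$ of variable nodes of $G(B)$ such that every check node $a$ of $G(B)$ adjacent to $U$ satisfies $|\partial a\cap U|\ge2$. -}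

module Defs where

open import Data.Nat using (ℕ; zero; suc; _+_; _≤_)
open import Data.Bool using (Bool; true; false; _∧_; _xor_; if_then_else_)
open import Data.Fin using (Fin; zero; suc; _≟_)
open import Data.Product using (_×_; _,_; ∃)
open import Relation.Nullary using (¬_; does)
open import Relation.Binary.PropositionalEquality using (_≡_)
open import Relation.Binary.Construct.Closure.ReflexiveTransitive using (Star)

-- n × n matrices over F₂ (Bool; true = 1), rows = check nodes, columns = variable nodes
Matrix : ℕ → Set
Matrix n = Fin n → Fin n → Bool

Subset : ℕ → Set
Subset n = Fin n → Bool

count : ∀ {n} → Subset n → ℕ
count {zero}  s = 0
count {suc n} s = (if s zero then 1 else 0) + count (λ k → s (suc k))

dot : ∀ {n} → (Fin n → Bool) → (Fin n → Bool) → Bool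
dot {zero}  a x = false
dot {suc n} a x = (a zero ∧ x zero) xor dot (λ k → a (suc k)) (λ k → x (suc k))

InKer : ∀ {n} → Matrix n → (Fin n → Bool) → Set
InKer A x = ∀ i → dot (A i) x ≡ false

-- kernel of the minor of A with rows C and columns V; vectors indexed by V are
-- represented as vectors on Fin n vanishing outside V
InKerMinor : ∀ {n} → Matrix n → Subset n → Subset n → (Fin n → Bool) → Set
InKerMinor A V C x = (∀ j → V j ≡ false → x j ≡ false)
                   × (∀ i → C i ≡ true → dot (A i) x ≡ false)

InF : ∀ {n} → Matrix n → Fin n → Set
InF A j = ∀ x → InKer A x → x j ≡ false

InFMinor : ∀ {n} → Matrix n → Subset n → Subset n → Fin n → Set
InFMinor A V C j = (V j ≡ true) × (∀ x → InKerMinor A V C x → x j ≡ false)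

IsFlipperMinor : ∀ {n} → Matrix n → Subset n → Subset n → Subset n → Set
IsFlipperMinor A V C U =
  (∀ j → U j ≡ true → V j ≡ true) ×
  (∀ a → C a ≡ true → (∃ λ j → (U j ≡ true) × (A a j ≡ true)) →
     2 ≤ count (λ j → U j ∧ A a j))

-- peeling process on the Tanner graph G(A); state = (alive variables, alive checks)
State : ℕ → Set
State n = Subset n × Subset n

remove : ∀ {n} → Fin n → Subset n → Subset n
remove j s k = if does (k ≟ j) then false else s k

degV : ∀ {n} → Matrix n → State n → Fin n → ℕ
degV A (V , C) j = count (λ i → C i ∧ A i j)

degC : ∀ {n} → Matrix n → State n → Fin n → ℕ
degC A (V , C) i = count (λ j → V j ∧ A i j)

data Step {n} (A : Matrix n) : State n → State n → Set where
  var0 : ∀ {V C} j → V j ≡ true → degV A (V , C) j ≡ 0 →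
         Step A (V , C) (remove j V , C)
  var1 : ∀ {V C} j i → V j ≡ true → degV A (V , C) j ≡ 1 → C i ≡ true → A i j ≡ true →
         Step A (V , C) (remove j V , remove i C)
  chk0 : ∀ {V C} i → C i ≡ true → degC A (V , C) i ≡ 0 →
         Step A (V , C) (V , remove i C)
  chk1 : ∀ {V C} i j → C i ≡ true → degC A (V , C) i ≡ 1 → V j ≡ true → A i j ≡ true →
         Step A (V , C) (remove j V , remove i C)

Terminal : ∀ {n} → Matrix n → State n → Set
Terminal A (V , C) = (∀ j → V j ≡ true → 2 ≤ degV A (V , C) j)
                   × (∀ i → C i ≡ true → 2 ≤ degC A (V , C) i)

-- (V, C) = (V_s(A), C_s(A)): result of a maximal peeling run started from G(A)
IsCore : ∀ {n} → Matrix n → Subset n → Subset n → Set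
IsCore A V C = Star (Step A) ((λ _ → true) , (λ _ → true)) (V , C) × Terminal A (V , C)

-- Every kernel vector of the core minor A_s is supported on U, because a variable of V_s
-- outside U is frozen. A check with a single neighbour j in U would therefore force x_j = 0
-- for every kernel vector, freezing j; so U is a flipper. If |U| + |C_s| < |V_s|, then the
-- |C_s| check equations restricted to the columns V_s ∖ U have a nonzero solution, which is a
-- kernel vector of A_s vanishing on U, a contradiction. Finally, every peeling step deletes a
-- node of degree at most one, and a kernel vector of the smaller graph extends to one of the
-- larger graph (a deleted variable of degree one takes the value that satisfies its unique
-- check). Hence kernel vectors of A_s extend to kernel vectors of A, and a variable that is
-- not frozen in A_s is not frozen in A.
module Submission where

open import Defs
open import Algebra.Bundles using (CommutativeRing)
open import Data.Bool using (Bool; true; false; _∧_; _xor_; if_then_else_; not)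
open import Data.Bool.Properties
  using (xor-∧-commutativeRing; ∧-distribʳ-xor; ∧-zeroʳ; xor-same; xor-comm; xor-assoc; xor-identityʳ)
open import Data.Fin using (Fin; zero; suc; _≟_)
open import Data.Fin.Properties using (suc-injective)
open import Data.List using (List; []; _∷_; length; map)
open import Data.List.Properties using (length-map)
open import Data.List.Relation.Unary.All as All using (All; []; _∷_)
open import Data.List.Relation.Unary.All.Properties using (map⁻)
open import Data.List.Relation.Binary.Permutation.Propositional
  using (_↭_; ↭-refl; ↭-sym; ↭-trans; prep; swap)
open import Data.List.Relation.Binary.Permutation.Propositional.Properties using (All-resp-↭; ↭-length)
open import Data.Nat using (ℕ; zero; suc; _+_; _≤_; _<_; z≤n; s≤s)
open import Data.Nat.Properties
  using (m≤n+m; m≤n⇒m≤1+n; ≤-trans; ≤-reflexive; <-≤-trans; <⇒≱; ≮⇒≥; +-suc; +-cancelˡ-<)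
open import Data.Product using (_×_; _,_; ∃; ∃₂; proj₁; proj₂)
open import Data.Sum using (_⊎_; inj₁; inj₂)
open import Data.Vec.Functional using (Vector; head; tail; updateAt; zipWith)
  renaming (_∷_ to _◂_)
open import Data.Vec.Functional.Properties using (updateAt-minimal)
open import Function using (_∘_; id)
open import Relation.Binary.Construct.Closure.ReflexiveTransitive using (Star; ε; _◅_)
open import Relation.Binary.PropositionalEquality
  using (_≡_; _≢_; refl; sym; trans; cong; cong₂; subst; module ≡-Reasoning)
open import Relation.Nullary using (¬_; yes; no; contradiction)

open import Algebra.Properties.CommutativeSemigroup
  (CommutativeRing.+-commutativeSemigroup xor-∧-commutativeRing) using (interchange)

private
  variable
    n m : ℕ
    A : Matrix n
    V C U : Subset n

_⊆_ : Subset n → Subset n → Set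
s ⊆ t = ∀ k → s k ≡ true → t k ≡ true

⊆-false : ∀ {s t : Subset n} → s ⊆ t → ∀ k → t k ≡ false → s k ≡ false
⊆-false {s = s} s⊆t k tk with s k in sk
... | false = refl
... | true  = contradiction (trans (sym (s⊆t k sk)) tk) λ ()

_─_ : Subset n → Subset n → Subset n
(s ─ t) k = s k ∧ not (t k)

count-pos : (s : Subset n) (j : Fin n) → s j ≡ true → 1 ≤ count s
count-pos s zero    sj rewrite sj = s≤s z≤n
count-pos s (suc j) sj = ≤-trans (count-pos (tail s) j sj) (m≤n+m _ _)

count-two : (s : Subset n) (j k : Fin n) → s j ≡ true → s k ≡ true → j ≢ k → 2 ≤ count s
count-two s zero    zero    _  _  j≢k = contradiction refl j≢k
count-two s zero    (suc k) sj sk _   rewrite sj = s≤s (count-pos (tail s) k sk)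
count-two s (suc j) zero    sj sk _   rewrite sk = s≤s (count-pos (tail s) j sj)
count-two s (suc j) (suc k) sj sk j≢k =
  ≤-trans (count-two (tail s) j k sj sk (j≢k ∘ cong suc)) (m≤n+m _ _)

count≡0⇒false : (s : Subset n) → count s ≡ 0 → ∀ k → s k ≡ false
count≡0⇒false s c k with s k in sk
... | false = refl
... | true  = contradiction (subst (1 ≤_) c (count-pos s k sk)) λ ()

count<2⇒unique : (s : Subset n) → count s < 2 → ∀ {j k} → s j ≡ true → s k ≡ true → j ≡ k
count<2⇒unique s lt {j} {k} sj sk with j ≟ k
... | yes j≡k = j≡k
... | no  j≢k = contradiction (count-two s j k sj sk j≢k) (<⇒≱ lt)

count-split-≤ : (s t : Subset n) → count s ≤ count t + count (s ─ t)
count-split-≤ {zero}  s t = z≤n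
count-split-≤ {suc n} s t with s zero | t zero | count-split-≤ (tail s) (tail t)
... | true  | true  | ih = s≤s ih
... | true  | false | ih = ≤-trans (s≤s ih) (≤-reflexive (sym (+-suc _ _)))
... | false | true  | ih = m≤n⇒m≤1+n ih
... | false | false | ih = ih

remove-self : (j : Fin n) (s : Subset n) → remove j s j ≡ false
remove-self j s with j ≟ j
... | yes _   = refl
... | no  j≢j = contradiction refl j≢j

remove-other : (j k : Fin n) (s : Subset n) → k ≢ j → remove j s k ≡ s k
remove-other j k s k≢j with k ≟ j
... | yes k≡j = contradiction k≡j k≢j
... | no  _   = refl

remove-false : (j : Fin n) (s : Subset n) → ∀ {k} → s k ≡ false → remove j s k ≡ false
remove-false j s {k} sk with k ≟ j
... | yes _ = refl
... | no  _ = sk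

dot-zero : (a x : Vector Bool n) → (∀ k → a k ∧ x k ≡ false) → dot a x ≡ false
dot-zero {zero}  a x h = refl
dot-zero {suc n} a x h = cong₂ _xor_ (h zero) (dot-zero (tail a) (tail x) (h ∘ suc))

dot-single : (a x : Vector Bool n) (j : Fin n) →
             (∀ k → k ≢ j → a k ∧ x k ≡ false) → dot a x ≡ a j ∧ x j
dot-single a x zero h =
  trans (cong (head a ∧ head x xor_) (dot-zero (tail a) (tail x) λ k → h (suc k) λ ()))
        (xor-identityʳ (head a ∧ head x))
dot-single a x (suc j) h =
  cong₂ _xor_ (h zero λ ()) (dot-single (tail a) (tail x) j λ k k≢j → h (suc k) (k≢j ∘ suc-injective))

dot-disjoint : (a x : Vector Bool n) → (∀ k → V k ∧ a k ≡ false) →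
               (∀ k → V k ≡ false → x k ≡ false) → dot a x ≡ false
dot-disjoint {V = V} a x disjoint supported = dot-zero a x vanishes
  where
  vanishes : ∀ k → a k ∧ x k ≡ false
  vanishes k with V k in vk
  ... | true  = cong (_∧ x k) (subst (λ b → b ∧ a k ≡ false) vk (disjoint k))
  ... | false = trans (cong (a k ∧_) (supported k vk)) (∧-zeroʳ (a k))

dot-xorˡ : (a c x : Vector Bool n) → dot (zipWith _xor_ a c) x ≡ dot a x xor dot c x
dot-xorˡ {zero}  a c x = refl
dot-xorˡ {suc n} a c x =
  trans (cong₂ _xor_ (∧-distribʳ-xor (head x) (head a) (head c)) (dot-xorˡ (tail a) (tail c) (tail x)))
        (interchange (head a ∧ head x) (head c ∧ head x) (dot (tail a) (tail x)) (dot (tail c) (tail x)))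

dot-updateAt : (a x : Vector Bool n) (j : Fin n) (b : Bool) → x j ≡ false →
               dot a (updateAt x j λ _ → b) ≡ dot a x xor (a j ∧ b)
dot-updateAt a x zero b xj rewrite xj =
  trans (xor-comm (head a ∧ b) rest)
        (cong (λ c → (c xor rest) xor (head a ∧ b)) (sym (∧-zeroʳ (head a))))
  where
  rest : Bool
  rest = dot (tail a) (tail x)
dot-updateAt a x (suc j) b xj =
  trans (cong (head a ∧ head x xor_) (dot-updateAt (tail a) (tail x) j b xj))
        (sym (xor-assoc (head a ∧ head x) (dot (tail a) (tail x)) (a (suc j) ∧ b)))

record NonzeroSolution (rs : List (Vector Bool n)) (W : Subset n) : Set where
  constructor solution
  field
    vec       : Vector Bool n
    nonzero   : ∃ λ k → vec k ≡ true
    supported : ∀ k → W k ≡ false → vec k ≡ false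
    solves    : All (λ r → dot r vec ≡ false) rs

NonzeroSolution-resp-↭ : ∀ {rs ss : List (Vector Bool n)} {W} →
                         rs ↭ ss → NonzeroSolution rs W → NonzeroSolution ss W
NonzeroSolution-resp-↭ rs↭ss (solution x nonzero supported solves) =
  solution x nonzero supported (All-resp-↭ rs↭ss solves)

pivot : (rs : List (Vector Bool (suc n))) →
        All (λ r → head r ≡ false) rs ⊎ ∃₂ λ p rest → head p ≡ true × rs ↭ p ∷ rest
pivot [] = inj₁ []
pivot (r ∷ rs) with head r in r₀ | pivot rs
... | true  | _ = inj₂ (r , rs , r₀ , ↭-refl)
... | false | inj₁ none = inj₁ (r₀ ∷ none)
... | false | inj₂ (p , rest , p₀ , rs↭) =
  inj₂ (p , r ∷ rest , p₀ , ↭-trans (prep r rs↭) (swap r p ↭-refl))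

extend-by-false : ∀ {rs} {W : Subset (suc n)} → W zero ≡ false →
                  NonzeroSolution (map tail rs) (tail W) → NonzeroSolution rs W
extend-by-false {W = W} w₀ (solution x (k , xk) supported solves) =
  solution (false ◂ x) (suc k , xk) supported′ (All.map (λ {r} → first-ignored r) (map⁻ solves))
  where
  supported′ : ∀ k → W k ≡ false → (false ◂ x) k ≡ false
  supported′ zero    _  = refl
  supported′ (suc k) wk = supported k wk
  first-ignored : ∀ r → dot (tail r) x ≡ false → dot r (false ◂ x) ≡ false
  first-ignored r = trans (cong (_xor dot (tail r) x) (∧-zeroʳ (head r)))

unit-solution : ∀ {rs} {W : Subset (suc n)} → W zero ≡ true →
                All (λ r → head r ≡ false) rs → NonzeroSolution rs W
unit-solution {W = W} w₀ none =
  solution (true ◂ λ _ → false) (zero , refl) supported (All.map (λ {r} → first-only r) none)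
  where
  supported : ∀ k → W k ≡ false → (true ◂ λ _ → false) k ≡ false
  supported zero    wk = contradiction (trans (sym w₀) wk) λ ()
  supported (suc k) _  = refl
  first-only : ∀ r → head r ≡ false → dot r (true ◂ λ _ → false) ≡ false
  first-only r r₀ rewrite r₀ = dot-zero (tail r) _ λ k → ∧-zeroʳ (tail r k)

eliminate : Vector Bool (suc n) → Vector Bool (suc n) → Vector Bool n
eliminate p r = if head r then zipWith _xor_ (tail r) (tail p) else tail r

-- The pivot variable takes the value that satisfies the pivot row; the other rows are then
-- equivalent to their eliminated forms.
back-substitute : ∀ {p rest} {W : Subset (suc n)} → head p ≡ true → W zero ≡ true →
                  NonzeroSolution (map (eliminate p) rest) (tail W) → NonzeroSolution (p ∷ rest) W
back-substitute {p = p} {W = W} p₀ w₀ (solution x (k , xk) supported solves) =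
  solution (d ◂ x) (suc k , xk) supported′ (pivot-row ∷ All.map (λ {r} → eliminated r) (map⁻ solves))
  where
  d : Bool
  d = dot (tail p) x
  supported′ : ∀ k → W k ≡ false → (d ◂ x) k ≡ false
  supported′ zero    wk = contradiction (trans (sym w₀) wk) λ ()
  supported′ (suc k) wk = supported k wk
  pivot-row : dot p (d ◂ x) ≡ false
  pivot-row rewrite p₀ = xor-same d
  eliminated : ∀ r → dot (eliminate p r) x ≡ false → dot r (d ◂ x) ≡ false
  eliminated r h with head r
  ... | true  = trans (xor-comm d _) (trans (sym (dot-xorˡ (tail r) (tail p) x)) h)
  ... | false = h

nonzeroSolution : (rs : List (Vector Bool n)) (W : Subset n) → length rs < count W → NonzeroSolution rs W
nonzeroSolution {zero}  rs W ()
nonzeroSolution {suc n} rs W lt with W zero in w₀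
... | false = extend-by-false w₀ (nonzeroSolution (map tail rs) (tail W)
                (subst (_< count (tail W)) (sym (length-map tail rs)) lt))
... | true with pivot rs
...   | inj₁ none = unit-solution w₀ none
...   | inj₂ (p , rest , p₀ , rs↭) =
  NonzeroSolution-resp-↭ (↭-sym rs↭) (back-substitute p₀ w₀ (nonzeroSolution _ (tail W) shorter))
  where
  shorter : length (map (eliminate p) rest) < count (tail W)
  shorter with s≤s lt′ ← subst (_< suc (count (tail W))) (↭-length rs↭) lt =
    subst (_< count (tail W)) (sym (length-map _ rest)) lt′

selectRows : (Fin m → Vector Bool n) → Subset m → List (Vector Bool n)
selectRows {zero}  R C = []
selectRows {suc m} R C =
  if head C then head R ∷ selectRows (tail R) (tail C) else selectRows (tail R) (tail C)

length-selectRows : (R : Fin m → Vector Bool n) (C : Subset m) → length (selectRows R C) ≡ count C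
length-selectRows {zero}  R C = refl
length-selectRows {suc m} R C with head C
... | true  = cong suc (length-selectRows (tail R) (tail C))
... | false = length-selectRows (tail R) (tail C)

All-selectRows⁻ : ∀ {P : Vector Bool n → Set} (R : Fin m → Vector Bool n) (C : Subset m) →
                  All P (selectRows R C) → ∀ i → C i ≡ true → P (R i)
All-selectRows⁻ R C all zero ci with head C
All-selectRows⁻ R C (pr ∷ _) zero refl | true = pr
All-selectRows⁻ R C all (suc i) ci with head C
... | true  = All-selectRows⁻ (tail R) (tail C) (All.tail all) i ci
... | false = All-selectRows⁻ (tail R) (tail C) all i ci

InKerState : Matrix n → State n → Vector Bool n → Set
InKerState A (V , C) = InKerMinor A V C

checks-remove : ∀ {x} (i : Fin n) → (∀ i′ → remove i C i′ ≡ true → dot (A i′) x ≡ false) →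
                dot (A i) x ≡ false → ∀ i′ → C i′ ≡ true → dot (A i′) x ≡ false
checks-remove {C = C} i checks ok i′ ci′ with i′ ≟ i
... | yes refl = ok
... | no  i′≢i = checks i′ (trans (remove-other i i′ C i′≢i) ci′)

lone-neighbour : (a : Vector Bool n) → count (λ k → V k ∧ a k) < 2 → ∀ {j} → V j ∧ a j ≡ true →
                 ∀ k → remove j V k ∧ a k ≡ false
lone-neighbour {V = V} a lt {j} vaj k with k ≟ j | V k in vk | a k in ak
... | yes _   | _     | _     = refl
... | no  _   | false | _     = refl
... | no  _   | true  | false = refl
... | no  k≢j | true  | true  = contradiction (count<2⇒unique _ lt (cong₂ _∧_ vk ak) vaj) k≢j

lift-step : ∀ {S S′ : State n} → Step A S S′ →
            ∀ x → InKerState A S′ x → ∃ λ y → InKerState A S y × x ⊆ y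
lift-step (var0 {V} j _ _) x (supported , checks) =
  x , ((λ k → supported k ∘ remove-false j V) , checks) , λ _ → id
lift-step {A = A} (chk0 {V} i _ deg₀) x (supported , checks) =
  x , (supported , checks-remove i checks satisfied) , λ _ → id
  where
  satisfied : dot (A i) x ≡ false
  satisfied = dot-disjoint (A i) x (count≡0⇒false _ deg₀) supported
lift-step {A = A} (chk1 {V} i j _ deg₁ vj aij) x (supported , checks) =
  x , ((λ k → supported k ∘ remove-false j V) , checks-remove i checks satisfied) , λ _ → id
  where
  satisfied : dot (A i) x ≡ false
  satisfied =
    dot-disjoint (A i) x (lone-neighbour (A i) (s≤s (≤-reflexive deg₁)) (cong₂ _∧_ vj aij)) supported
lift-step {A = A} (var1 {V} {C} j i vj deg₁ ci aij) x (supported , checks) =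
  y , (supported′ , checks-remove i others satisfied) , x⊆y
  where
  open ≡-Reasoning
  d : Bool
  d = dot (A i) x
  y : Vector Bool _
  y = updateAt x j λ _ → d
  xj : x j ≡ false
  xj = supported j (remove-self j V)
  y-other : ∀ k → k ≢ j → y k ≡ x k
  y-other k k≢j = updateAt-minimal k j x k≢j
  supported′ : ∀ k → V k ≡ false → y k ≡ false
  supported′ k vk = trans (y-other k λ { refl → contradiction (trans (sym vj) vk) λ () })
                          (supported k (remove-false j V vk))
  satisfied : dot (A i) y ≡ false
  satisfied = begin
    dot (A i) y         ≡⟨ dot-updateAt (A i) x j d xj ⟩
    d xor (A i j ∧ d)   ≡⟨ cong (λ b → d xor (b ∧ d)) aij ⟩
    d xor d             ≡⟨ xor-same d ⟩
    false               ∎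
  others : ∀ i′ → remove i C i′ ≡ true → dot (A i′) y ≡ false
  others i′ ci′ = begin
    dot (A i′) y                   ≡⟨ dot-updateAt (A i′) x j d xj ⟩
    dot (A i′) x xor (A i′ j ∧ d)  ≡⟨ cong (λ b → dot (A i′) x xor (b ∧ d)) not-adjacent ⟩
    dot (A i′) x xor false         ≡⟨ xor-identityʳ _ ⟩
    dot (A i′) x                   ≡⟨ checks i′ ci′ ⟩
    false                          ∎
    where
    not-adjacent : A i′ j ≡ false
    not-adjacent = subst (λ b → b ∧ A i′ j ≡ false) ci′
      (lone-neighbour (λ i → A i j) (s≤s (≤-reflexive deg₁)) (cong₂ _∧_ ci aij) i′)
  x⊆y : x ⊆ y
  x⊆y k xk = trans (y-other k λ { refl → contradiction (trans (sym xk) xj) λ () }) xk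

lift-peeling : ∀ {S T : State n} → Star (Step A) S T →
               ∀ x → InKerState A T x → ∃ λ y → InKerState A S y × x ⊆ y
lift-peeling ε x ker = x , ker , λ _ → id
lift-peeling (step ◅ steps) x ker =
  let z , kerZ , x⊆z = lift-peeling steps x ker
      y , kerY , z⊆y = lift-step step z kerZ
  in  y , kerY , λ k → z⊆y k ∘ x⊆z k

InF⇒InFMinor : Star (Step A) ((λ _ → true) , (λ _ → true)) (V , C) →
               ∀ {j} → V j ≡ true → InF A j → InFMinor A V C j
InF⇒InFMinor peeling vj frozen = vj , λ x ker →
  let y , (_ , checks) , x⊆y = lift-peeling peeling x ker
  in  ⊆-false x⊆y _ (frozen y λ i → checks i refl)

Unfrozen : Matrix n → Subset n → Subset n → Fin n → Set
Unfrozen A V C j = (V j ≡ true) × ¬ InFMinor A V C j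

kerMinor⊆unfrozen : (∀ j → Unfrozen A V C j → U j ≡ true) → ∀ {x} → InKerMinor A V C x → x ⊆ U
kerMinor⊆unfrozen {V = V} unfrozen⊆U {x} ker@(supported , _) k xk with V k in vk
... | true  = unfrozen⊆U k (vk , λ (_ , frozen) → contradiction (trans (sym xk) (frozen x ker)) λ ())
... | false = contradiction (trans (sym xk) (supported k vk)) λ ()

unfrozen-isFlipper : (∀ j → U j ≡ true → Unfrozen A V C j) →
                     (∀ j → Unfrozen A V C j → U j ≡ true) →
                     IsFlipperMinor A V C U
unfrozen-isFlipper {U = U} {A = A} {V = V} {C = C} U⊆unfrozen unfrozen⊆U =
  (λ j → proj₁ ∘ U⊆unfrozen j) , flips
  where
  flips : ∀ a → C a ≡ true → (∃ λ j → (U j ≡ true) × (A a j ≡ true)) →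
          2 ≤ count (λ j → U j ∧ A a j)
  flips a ca (j , uj , aj) =
    ≮⇒≥ λ lt → proj₂ (U⊆unfrozen j uj) (proj₁ (U⊆unfrozen j uj) , frozen lt)
    where
    open ≡-Reasoning
    frozen : count (λ j → U j ∧ A a j) < 2 → ∀ x → InKerMinor A V C x → x j ≡ false
    frozen lt x ker@(_ , checks) = begin
      x j            ≡⟨ cong (_∧ x j) (sym aj) ⟩
      A a j ∧ x j    ≡⟨ dot-single (A a) x j others ⟨
      dot (A a) x    ≡⟨ checks a ca ⟩
      false          ∎
      where
      others : ∀ k → k ≢ j → A a k ∧ x k ≡ false
      others k k≢j with x k in xk | A a k in ak
      ... | false | b     = ∧-zeroʳ b
      ... | true  | false = refl
      ... | true  | true  = contradiction
        (count<2⇒unique _ lt (cong₂ _∧_ (kerMinor⊆unfrozen unfrozen⊆U ker k xk) ak) (cong₂ _∧_ uj aj))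
        k≢j

-- A nonzero solution of the check equations on the columns V ∖ U would be a kernel vector
-- vanishing on U.
count-unfrozen-bound : (∀ j → Unfrozen A V C j → U j ≡ true) → count V ≤ count U + count C
count-unfrozen-bound {A = A} {V = V} {C = C} {U = U} unfrozen⊆U = ≮⇒≥ λ lt →
  let solution x (k , xk) supported solves = nonzeroSolution (selectRows A C) (V ─ U) (few-rows lt)
      ker : InKerMinor A V C x
      ker = (λ j vj → supported j (cong (λ b → b ∧ not (U j)) vj)) , All-selectRows⁻ A C solves
      uk : U k ≡ true
      uk = kerMinor⊆unfrozen unfrozen⊆U ker k xk
      outside : (V ─ U) k ≡ false
      outside = trans (cong (λ b → V k ∧ not b) uk) (∧-zeroʳ (V k))
  in  contradiction (trans (sym xk) (supported k outside)) λ ()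
  where
  few-rows : count U + count C < count V → length (selectRows A C) < count (V ─ U)
  few-rows lt = subst (_< count (V ─ U)) (sym (length-selectRows A C))
    (+-cancelˡ-< (count U) (count C) (count (V ─ U)) (<-≤-trans lt (count-split-≤ V U)))

lemma8p2 : ∀ (n : ℕ) (A : Matrix n) (Vs Cs : Subset n) → IsCore A Vs Cs →
    ∀ (U : Subset n) →
    (∀ j → U j ≡ true → (Vs j ≡ true) × ¬ InFMinor A Vs Cs j) →
    (∀ j → (Vs j ≡ true) × ¬ InFMinor A Vs Cs j → U j ≡ true) →
    IsFlipperMinor A Vs Cs U
      × (count Vs ≤ count U + count Cs)
      × (∀ j → U j ≡ true → ¬ InF A j)
lemma8p2 _ _ _ _ (peeling , _) _ U⊆unfrozen unfrozen⊆U =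
    unfrozen-isFlipper U⊆unfrozen unfrozen⊆U
  , count-unfrozen-bound unfrozen⊆U
  , λ j uj → let vj , unfrozen = U⊆unfrozen j uj in unfrozen ∘ InF⇒InFMinor peeling vj
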